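{- Let $G_1,\ldots,G_h$ be a collection of $h>1$ graphs such that for each $1\le i\le h$, $N\le|V(G_i)|\le\gamma N$ and $G_i$ is a $\psi$-expander, for some $N\ge1$, $\gamma\ge1$ and $0<\psi\le1$. Let $H$ be a graph with vertex set $\{v_1,\ldots,v_h\}$ that is a $\psi'$-expander, and let $\Delta$ be the maximum vertex degree in $H$. Let $G$ be a graph that is an $N$-composition of $H$ with $G_1,\ldots,G_h$. Then $G$ is a $\psi''$-expander for $\psi''=\psi\psi'/(16\Delta\gamma^2)$.
   Context: Graphs are undirected and unweighted, possibly with parallel edges but no self-loops. For a graph $K=(V,E)$, the sparsity of a cut $\emptyset\neq S\subsetneq V$ is $\frac{|E_K(S,V\setminus S)|}{\min\{|S|,|V\setminus S|\}}$; $K$ is a $\psi$-expander if every cut has sparsity at least $\psi$. Given disjoint graphs $G_1,\ldots,G_h$ with vertex sets $V_i=V(G_i)$, each of cardinality at least $N$, and a graph $H$ on vertex set $\{v_1,\ldots,v_h\}$, an $N$-composition of $H$ with $G_1,\ldots,G_h$ is a graph $G$ with vertex set $\bigcup_iV_i$ whose edge set is $\bigcup_iE(G_i)$ together with, for each edge $e=(v_i,v_j)\in E(H)$, an arbitrary matching $M(e)$ of cardinality $N$ between vertices of $V_i$ and vertices of $V_j$.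
   Formalization: The parameters ψ, ψ′ and γ range over the rationals. -}

module Defs where

open import Data.Bool using (Bool; true; false; not; _xor_)
open import Data.Nat as ℕ using (ℕ; zero; suc; _⊔_)
open import Data.Integer using (+_)
open import Data.Fin as Fin using (Fin)
open import Data.Bool using (_∨_)
open import Relation.Nullary.Decidable using (isYes)
open import Data.List using (List; []; _∷_; map; concat; concatMap; filterᵇ; length; allFin; lookup; foldr; _++_)
open import Data.List.Relation.Unary.All using (All)
open import Data.List.Relation.Unary.Unique.Propositional using (Unique)
open import Data.Product using (Σ; _×_; _,_; proj₁; proj₂)
open import Data.Rational as ℚ using (ℚ; 0ℚ; _≤_; _*_; _÷_)
open import Data.Rational.Properties using (_≟_)
open import Relation.Binary.PropositionalEquality using (_≡_; _≢_)
open import Relation.Nullary using (yes; no)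

toℚ : ℕ → ℚ
toℚ n = (+ n) ℚ./ 1

-- total division on ℚ (x ÷₀ 0 = 0); only used with nonzero denominators
-- except in degenerate cases
_÷₀_ : ℚ → ℚ → ℚ
p ÷₀ q with q ≟ 0ℚ
... | yes _ = 0ℚ
... | no q≢0 = _÷_ p q {{ℚ.≢-nonZero q≢0}}

-- A (multi)graph on vertex type V is given by its list of edges
-- (a list, so parallel edges are allowed); an edge (u , v) is undirected.
Edges : Set → Set
Edges V = List (V × V)

Loopless : {V : Set} → Edges V → Set
Loopless E = All (λ e → proj₁ e ≢ proj₂ e) E

count : {A : Set} → (A → Bool) → List A → ℕ
count p xs = length (filterᵇ p xs)

-- A cut is a boolean predicate S on vertices; |E(S, V∖S)|
crossing : {V : Set} → (V → Bool) → Edges V → ℕ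
crossing S E = count (λ e → S (proj₁ e) xor S (proj₂ e)) E

sparsity : {V : Set} → List V → Edges V → (V → Bool) → ℚ
sparsity vs E S =
  toℚ (crossing S E) ÷₀ toℚ (count S vs ℕ.⊓ count (λ v → not (S v)) vs)

IsExpander : {V : Set} → List V → Edges V → ℚ → Set
IsExpander {V} vs E ψ = (S : V → Bool) → 1 ℕ.≤ count S vs → 1 ℕ.≤ count (λ v → not (S v)) vs
                  → ψ ≤ sparsity vs E S

degree : {h : ℕ} → Edges (Fin h) → Fin h → ℕ
degree E v = count (λ e → isYes (proj₁ e Fin.≟ v) ∨ isYes (proj₂ e Fin.≟ v)) E

maxDegree : (h : ℕ) → Edges (Fin h) → ℕ
maxDegree h E = foldr _⊔_ 0 (map (degree E) (allFin h))

-- vertex set of the union of disjoint graphs G_1..G_h with |V(G_i)| = n i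
UnionV : (h : ℕ) → (Fin h → ℕ) → Set
UnionV h n = Σ (Fin h) (λ i → Fin (n i))

unionVs : (h : ℕ) (n : Fin h → ℕ) → List (UnionV h n)
unionVs h n = concatMap (λ i → map (i ,_) (allFin (n i))) (allFin h)

record Matching (N a b : ℕ) : Set where
  field
    pairs    : List (Fin a × Fin b)
    card     : length pairs ≡ N
    uniqueˡ  : Unique (map proj₁ pairs)
    uniqueʳ  : Unique (map proj₂ pairs)
open Matching public

-- data of an N-composition of H (edge list EH on Fin h) with G_1..G_h:
-- for each edge e = (v_i , v_j) of H, a matching M(e) of size N between V_i and V_j
CompositionData : (N h : ℕ) (n : Fin h → ℕ) → Edges (Fin h) → Set
CompositionData N h n EH =
  (k : Fin (length EH)) → Matching N (n (proj₁ (lookup EH k))) (n (proj₂ (lookup EH k)))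

compositionEdges : (N h : ℕ) (n : Fin h → ℕ) (EG : (i : Fin h) → Edges (Fin (n i)))
                   (EH : Edges (Fin h)) → CompositionData N h n EH → Edges (UnionV h n)
compositionEdges N h n EG EH M =
  concatMap (λ i → map (λ e → ((i , proj₁ e) , (i , proj₂ e))) (EG i)) (allFin h)
  ++ concatMap (λ k → map (λ p → ((proj₁ (lookup EH k) , proj₁ p) , (proj₂ (lookup EH k) , proj₂ p)))
                          (pairs (M k)))
               (allFin (length EH))

module Submission where

-- Fix a cut S of G with both sides nonempty and let S_i = S ∩ V(G_i).  Call the
-- smaller of S_i, V(G_i) ∖ S_i the minority side of G_i, with m_i vertices, and let
-- M = Σ m_i.  Contracting every G_i to the side of its majority gives a cut A of H,
-- with a = min(|A|, |V(H) ∖ A|) and boundary e.  Writing c = c_I + c_M for the edges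
-- of G crossing S, split into internal edges (inside some G_i) and matching edges:
--   * ψ·M ≤ c_I, because each G_i is a ψ-expander;
--   * ψ'·a ≤ e, and e·N ≤ c_M + Δ·M: each of the N matched pairs over a boundary
--     edge of A crosses S or meets a minority vertex (handshake bound for the latter);
--   * min(|S|, |V ∖ S|) ≤ γN·a + M, and ψ' ≤ Δ (test H on a single vertex).
-- Eliminating M, a and e yields ψψ'·min(|S|, |V ∖ S|) ≤ 16Δγ²·c.

open import Defs
open import Data.Nat using (ℕ)
import Data.Nat as ℕ
open import Data.Fin using (Fin)
open import Data.Bool using (Bool)

module RationalArithmetic where

  open import Defs using (toℚ; _÷₀_)
  open import Data.Nat as ℕ using (ℕ; zero; suc)
  open import Data.Integer as ℤ using (+_)
  import Data.Integer.Properties as ℤP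
  import Data.Nat.Coprimality as Coprime
  open import Data.Rational as ℚ using (ℚ; 0ℚ; 1ℚ; _*_; _+_; _≤_; _<_; mkℚ)
  import Data.Rational.Properties as ℚP
  open import Data.Rational.Solver using (module +-*-Solver)
  open import Relation.Binary.Definitions using (tri<; tri≈; tri>)
  open import Relation.Binary.PropositionalEquality
  open import Data.Empty using (⊥-elim)
  open import Data.Sum using (inj₁; inj₂)
  import Data.Nat.Properties as ℕP
  open import Relation.Nullary using (yes; no)
  open ℚP.≤-Reasoning
  open +-*-Solver

  -- toℚ n is the normalised fraction n/1; the homomorphism properties below
  -- are read off from this normal form.
  toℚ-mkℚ : ∀ n → toℚ n ≡ mkℚ (+ n) 0 (Coprime.sym (Coprime.1-coprimeTo n))
  toℚ-mkℚ n = ℚP.normalize-coprime (Coprime.sym (Coprime.1-coprimeTo n))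

  toℚ-+ : ∀ a b → toℚ (a ℕ.+ b) ≡ toℚ a + toℚ b
  toℚ-+ a b rewrite toℚ-mkℚ a | toℚ-mkℚ b =
    trans (ℚP.normalize-coprime (Coprime.sym (Coprime.1-coprimeTo (a ℕ.+ b))))
      (sym (trans (ℚP./-cong (cong₂ ℤ._+_ (ℤP.*-identityʳ (+ a)) (ℤP.*-identityʳ (+ b))) refl)
                  (ℚP.normalize-coprime (Coprime.sym (Coprime.1-coprimeTo (a ℕ.+ b))))))

  toℚ-* : ∀ a b → toℚ (a ℕ.* b) ≡ toℚ a * toℚ b
  toℚ-* a b rewrite toℚ-mkℚ a | toℚ-mkℚ b = ℚP./-cong {+ (a ℕ.* b)} (ℤP.pos-* a b) refl

  toℚ-mono : ∀ {a b} → a ℕ.≤ b → toℚ a ≤ toℚ b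
  toℚ-mono {a} {b} a≤b rewrite toℚ-mkℚ a | toℚ-mkℚ b =
    ℚ.*≤* (ℤP.*-monoʳ-≤-nonNeg (+ 1) (ℤ.+≤+ a≤b))

  toℚ-nonNeg : ∀ a → 0ℚ ≤ toℚ a
  toℚ-nonNeg a = toℚ-mono {0} {a} ℕ.z≤n

  toℚ-pos : ∀ {a} → 1 ℕ.≤ a → 0ℚ < toℚ a
  toℚ-pos {suc k} _ rewrite toℚ-mkℚ (suc k) = ℚP.positive⁻¹ _

  toℚ-⊓-bound : ∀ x y p q (F : ℕ → ℚ) → toℚ x ≤ F p → toℚ y ≤ F q → toℚ (x ℕ.⊓ y) ≤ F (p ℕ.⊓ q)
  toℚ-⊓-bound x y p q F x≤Fp y≤Fq with ℕP.≤-total p q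
  ... | inj₁ p≤q = ℚP.≤-trans (toℚ-mono (ℕP.m⊓n≤m x y)) (subst (λ z → toℚ x ≤ F z) (sym (ℕP.m≤n⇒m⊓n≡m p≤q)) x≤Fp)
  ... | inj₂ q≤p = ℚP.≤-trans (toℚ-mono (ℕP.m⊓n≤n x y)) (subst (λ z → toℚ y ≤ F z) (sym (ℕP.m≥n⇒m⊓n≡n q≤p)) y≤Fq)

  1≤⇒0≤ : ∀ {p} → 1ℚ ≤ p → 0ℚ ≤ p
  1≤⇒0≤ = ℚP.≤-trans (toℚ-nonNeg 1)

  *-monoˡ-≤-0≤ : ∀ {p q} r → 0ℚ ≤ r → p ≤ q → r * p ≤ r * q
  *-monoˡ-≤-0≤ r 0≤r = ℚP.*-monoˡ-≤-nonNeg r {{ℚ.nonNegative 0≤r}}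

  *-monoʳ-≤-0≤ : ∀ {p q} r → 0ℚ ≤ r → p ≤ q → p * r ≤ q * r
  *-monoʳ-≤-0≤ r 0≤r = ℚP.*-monoʳ-≤-nonNeg r {{ℚ.nonNegative 0≤r}}

  0≤-* : ∀ {p q} → 0ℚ ≤ p → 0ℚ ≤ q → 0ℚ ≤ p * q
  0≤-* {p} {q} 0≤p 0≤q = begin
    0ℚ     ≡⟨ sym (ℚP.*-zeroˡ q) ⟩
    0ℚ * q ≤⟨ *-monoʳ-≤-0≤ q 0≤q 0≤p ⟩
    p * q  ∎

  ÷₀-cancel : ∀ x D → 0ℚ < D → (x ÷₀ D) * D ≡ x
  ÷₀-cancel x D 0<D with D ℚP.≟ 0ℚ
  ... | yes D≡0 = ⊥-elim (ℚP.<-irrefl (sym D≡0) 0<D)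
  ... | no D≢0 = begin-equality
    x * ℚ.1/ D * D   ≡⟨ ℚP.*-assoc x _ D ⟩
    x * (ℚ.1/ D * D) ≡⟨ cong (x *_) (ℚP.*-inverseˡ D) ⟩
    x * 1ℚ           ≡⟨ ℚP.*-identityʳ x ⟩
    x                ∎
    where instance _ = ℚ.≢-nonZero D≢0

  ÷₀-intro : ∀ {q x D} → 0ℚ < D → q * D ≤ x → q ≤ x ÷₀ D
  ÷₀-intro {q} {x} {D} 0<D qD≤x = ℚP.*-cancelʳ-≤-pos D {{ℚ.positive 0<D}} (begin
    q * D          ≤⟨ qD≤x ⟩
    x              ≡⟨ sym (÷₀-cancel x D 0<D) ⟩
    (x ÷₀ D) * D   ∎)

  ÷₀-elim : ∀ {q x D} → 0ℚ < D → q ≤ x ÷₀ D → q * D ≤ x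
  ÷₀-elim {q} {x} {D} 0<D q≤x/D = begin
    q * D          ≤⟨ *-monoʳ-≤-0≤ D (ℚP.<⇒≤ 0<D) q≤x/D ⟩
    (x ÷₀ D) * D   ≡⟨ ÷₀-cancel x D 0<D ⟩
    x              ∎

  -- To bound (P ÷₀ D) * m by c it suffices to bound P * m by D * c, because
  -- for D = 0 the quotient is 0.
  ÷₀-numerator : ∀ {P D m c} → 0ℚ ≤ D → 0ℚ ≤ c
               → (0ℚ < D → P * m ≤ D * c) → (P ÷₀ D) * m ≤ c
  ÷₀-numerator {P} {D} {m} {c} 0≤D 0≤c bound with ℚP.<-cmp 0ℚ D
  ... | tri> _ _ D<0 = ⊥-elim (ℚP.<-irrefl refl (ℚP.<-≤-trans D<0 0≤D))
  ... | tri≈ _ refl _ = ℚP.≤-trans (ℚP.≤-reflexive (ℚP.*-zeroˡ m)) 0≤c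
  ... | tri< 0<D _ _ = ℚP.*-cancelʳ-≤-pos D {{ℚ.positive 0<D}} (begin
    (P ÷₀ D) * m * D   ≡⟨ solve 3 (λ Q m D → Q :* m :* D := Q :* D :* m) refl (P ÷₀ D) m D ⟩
    (P ÷₀ D) * D * m   ≡⟨ cong (_* m) (÷₀-cancel P D 0<D) ⟩
    P * m              ≤⟨ bound 0<D ⟩
    D * c              ≡⟨ ℚP.*-comm D c ⟩
    c * D              ∎)

  γ-absorb : ∀ γ x → 1ℚ ≤ γ → 0ℚ ≤ x → γ * x + x ≤ toℚ 16 * (γ * γ) * x
  γ-absorb γ x 1≤γ 0≤x = begin
    γ * x + x                                       ≤⟨ ℚP.+-mono-≤ γx≤γ²x x≤γ²x ⟩
    γ * γ * x + γ * γ * x                           ≡⟨ sym (ℚP.+-identityʳ _) ⟩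
    γ * γ * x + γ * γ * x + 0ℚ                      ≤⟨ ℚP.+-monoʳ-≤ (γ * γ * x + γ * γ * x) 0≤14γ²x ⟩
    γ * γ * x + γ * γ * x + toℚ 14 * (γ * γ * x)    ≡⟨ solve 2 (λ γ x → γ :* γ :* x :+ γ :* γ :* x :+ con (toℚ 14) :* (γ :* γ :* x)
                                                                 := con (toℚ 16) :* (γ :* γ) :* x) refl γ x ⟩
    toℚ 16 * (γ * γ) * x                            ∎
    where
    0≤γ : 0ℚ ≤ γ
    0≤γ = 1≤⇒0≤ 1≤γ
    γ≤γ² : γ ≤ γ * γ
    γ≤γ² = begin γ ≡⟨ sym (ℚP.*-identityʳ γ) ⟩ γ * 1ℚ ≤⟨ *-monoˡ-≤-0≤ γ 0≤γ 1≤γ ⟩ γ * γ ∎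
    γx≤γ²x : γ * x ≤ γ * γ * x
    γx≤γ²x = *-monoʳ-≤-0≤ x 0≤x γ≤γ²
    x≤γ²x : x ≤ γ * γ * x
    x≤γ²x = begin x ≡⟨ sym (ℚP.*-identityˡ x) ⟩ 1ℚ * x ≤⟨ *-monoʳ-≤-0≤ x 0≤x (ℚP.≤-trans 1≤γ γ≤γ²) ⟩ γ * γ * x ∎
    0≤14γ²x : 0ℚ ≤ toℚ 14 * (γ * γ * x)
    0≤14γ²x = 0≤-* (toℚ-nonNeg 14) (0≤-* (0≤-* 0≤γ 0≤γ) 0≤x)

  -- The cut
  -- edges are cI internal ones (inside the G_i) and cM matching ones; M is the total
  -- minority, a and e the size and boundary of the contracted cut of H, and μ the
  -- size of the cut.
  cut-inequality : (ψ ψ' γ Δ N a M cI cM e μ : ℚ)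
    → 0ℚ ≤ ψ → ψ ≤ 1ℚ → 1ℚ ≤ γ → 0ℚ ≤ ψ' → ψ' ≤ Δ → 1ℚ ≤ Δ → 0ℚ ≤ N → 0ℚ ≤ cI → 0ℚ ≤ cM
    → ψ * M ≤ cI → e * N ≤ cM + Δ * M → ψ' * a ≤ e → μ ≤ γ * N * a + M
    → ψ * ψ' * μ ≤ γ * (Δ * (cI + cM)) + Δ * (cI + cM)
  cut-inequality ψ ψ' γ Δ N a M cI cM e μ 0≤ψ ψ≤1 1≤γ 0≤ψ' ψ'≤Δ 1≤Δ 0≤N 0≤cI 0≤cM
                 internal matching contracted size = begin
    ψ * ψ' * μ                               ≤⟨ *-monoˡ-≤-0≤ (ψ * ψ') (0≤-* 0≤ψ 0≤ψ') size ⟩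
    ψ * ψ' * (γ * N * a + M)                 ≡⟨ solve 6 (λ ψ ψ' γ N a M → ψ :* ψ' :* (γ :* N :* a :+ M)
                                                   := γ :* (ψ :* N) :* (ψ' :* a) :+ ψ' :* (ψ :* M)) refl ψ ψ' γ N a M ⟩
    γ * (ψ * N) * (ψ' * a) + ψ' * (ψ * M)    ≤⟨ ℚP.+-mono-≤ (*-monoˡ-≤-0≤ (γ * (ψ * N)) 0≤γψN contracted)
                                                             (*-monoˡ-≤-0≤ ψ' 0≤ψ' internal) ⟩
    γ * (ψ * N) * e + ψ' * cI                ≡⟨ cong (_+ ψ' * cI) (solve 4 (λ γ ψ N e → γ :* (ψ :* N) :* e
                                                   := γ :* (ψ :* (e :* N))) refl γ ψ N e) ⟩
    γ * (ψ * (e * N)) + ψ' * cI              ≤⟨ ℚP.+-mono-≤ (*-monoˡ-≤-0≤ γ 0≤γ ψeN≤Δc) ψ'cI≤Δc ⟩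
    γ * (Δ * (cI + cM)) + Δ * (cI + cM)      ∎
    where
    0≤γ : 0ℚ ≤ γ
    0≤γ = 1≤⇒0≤ 1≤γ
    0≤Δ : 0ℚ ≤ Δ
    0≤Δ = 1≤⇒0≤ 1≤Δ
    0≤γψN : 0ℚ ≤ γ * (ψ * N)
    0≤γψN = 0≤-* 0≤γ (0≤-* 0≤ψ 0≤N)
    cI≤c : cI ≤ cI + cM
    cI≤c = begin cI ≡⟨ sym (ℚP.+-identityʳ cI) ⟩ cI + 0ℚ ≤⟨ ℚP.+-monoʳ-≤ cI 0≤cM ⟩ cI + cM ∎
    ψeN≤Δc : ψ * (e * N) ≤ Δ * (cI + cM)
    ψeN≤Δc = begin
      ψ * (e * N)               ≤⟨ *-monoˡ-≤-0≤ ψ 0≤ψ matching ⟩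
      ψ * (cM + Δ * M)          ≡⟨ solve 4 (λ ψ cM Δ M → ψ :* (cM :+ Δ :* M) := ψ :* cM :+ Δ :* (ψ :* M)) refl ψ cM Δ M ⟩
      ψ * cM + Δ * (ψ * M)      ≤⟨ ℚP.+-mono-≤ (*-monoʳ-≤-0≤ cM 0≤cM (ℚP.≤-trans ψ≤1 1≤Δ)) (*-monoˡ-≤-0≤ Δ 0≤Δ internal) ⟩
      Δ * cM + Δ * cI           ≡⟨ solve 3 (λ Δ cM cI → Δ :* cM :+ Δ :* cI := Δ :* (cI :+ cM)) refl Δ cM cI ⟩
      Δ * (cI + cM)             ∎
    ψ'cI≤Δc : ψ' * cI ≤ Δ * (cI + cM)
    ψ'cI≤Δc = ℚP.≤-trans (*-monoʳ-≤-0≤ cI 0≤cI ψ'≤Δ) (*-monoˡ-≤-0≤ Δ 0≤Δ cI≤c)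

  -- cut-inequality for natural-number counts, with the constant of the theorem:
  -- ψψ'·μ ≤ γΔc + Δc ≤ 16Δγ²·c for c = cI + cM.
  scaled-cut-bound : (ψ ψ' γ : ℚ) (Δ N a M cI cM e μ : ℕ)
    → 0ℚ ≤ ψ → ψ ≤ 1ℚ → 1ℚ ≤ γ → 0ℚ ≤ ψ' → ψ' ≤ toℚ Δ → 1 ℕ.≤ Δ
    → ψ * toℚ M ≤ toℚ cI → e ℕ.* N ℕ.≤ cM ℕ.+ Δ ℕ.* M → ψ' * toℚ a ≤ toℚ e
    → toℚ μ ≤ γ * toℚ N * toℚ a + toℚ M
    → ψ * ψ' * toℚ μ ≤ toℚ (16 ℕ.* Δ) * (γ * γ) * toℚ (cI ℕ.+ cM)
  scaled-cut-bound ψ ψ' γ Δ N a M cI cM e μ 0≤ψ ψ≤1 1≤γ 0≤ψ' ψ'≤Δ 1≤Δ internal matching contracted size = begin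
    ψ * ψ' * toℚ μ
      ≤⟨ cut-inequality ψ ψ' γ (toℚ Δ) (toℚ N) (toℚ a) (toℚ M) (toℚ cI) (toℚ cM) (toℚ e) (toℚ μ)
           0≤ψ ψ≤1 1≤γ 0≤ψ' ψ'≤Δ (toℚ-mono {1} {Δ} 1≤Δ) (toℚ-nonNeg N) (toℚ-nonNeg cI) (toℚ-nonNeg cM)
           internal matchingℚ contracted size ⟩
    γ * (toℚ Δ * (toℚ cI + toℚ cM)) + toℚ Δ * (toℚ cI + toℚ cM)
      ≤⟨ γ-absorb γ _ 1≤γ (0≤-* (toℚ-nonNeg Δ) (ℚP.≤-trans (toℚ-nonNeg cI) cI≤c)) ⟩
    toℚ 16 * (γ * γ) * (toℚ Δ * (toℚ cI + toℚ cM))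
      ≡⟨ solve 4 (λ γ Δ cI cM → con (toℚ 16) :* (γ :* γ) :* (Δ :* (cI :+ cM))
                    := con (toℚ 16) :* Δ :* (γ :* γ) :* (cI :+ cM)) refl γ (toℚ Δ) (toℚ cI) (toℚ cM) ⟩
    toℚ 16 * toℚ Δ * (γ * γ) * (toℚ cI + toℚ cM)
      ≡⟨ sym (cong₂ (λ x y → x * (γ * γ) * y) (toℚ-* 16 Δ) (toℚ-+ cI cM)) ⟩
    toℚ (16 ℕ.* Δ) * (γ * γ) * toℚ (cI ℕ.+ cM) ∎
    where
    matchingℚ : toℚ e * toℚ N ≤ toℚ cM + toℚ Δ * toℚ M
    matchingℚ = subst₂ _≤_ (toℚ-* e N) (trans (toℚ-+ cM _) (cong (λ z → toℚ cM + z) (toℚ-* Δ M))) (toℚ-mono matching)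
    cI≤c : toℚ cI ≤ toℚ cI + toℚ cM
    cI≤c = subst (toℚ cI ≤_) (toℚ-+ cI cM) (toℚ-mono (ℕP.m≤m+n cI cM))

  -- The bound on the sparsity of one cut: ψψ'/(16Δγ²) ≤ c/μ for c = cI + cM.
  -- It is trivial when ψ' ≤ 0 or when the denominator 16Δγ² vanishes, and
  -- otherwise it is scaled-cut-bound.
  expansion-from-counts : (ψ ψ' γ : ℚ) (Δ N a M cI cM c e μ : ℕ)
    → cI ℕ.+ cM ≡ c → 0ℚ < ψ → ψ ≤ 1ℚ → 1ℚ ≤ γ → ψ' ≤ toℚ Δ
    → ψ * toℚ M ≤ toℚ cI → e ℕ.* N ℕ.≤ cM ℕ.+ Δ ℕ.* M → ψ' * toℚ a ≤ toℚ e
    → toℚ μ ≤ γ * toℚ N * toℚ a + toℚ M → 1 ℕ.≤ μ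
    → (ψ * ψ') ÷₀ (toℚ (16 ℕ.* Δ) * (γ * γ)) ≤ toℚ c ÷₀ toℚ μ
  expansion-from-counts ψ ψ' γ Δ N a M cI cM _ e μ refl 0<ψ ψ≤1 1≤γ ψ'≤Δ internal matching contracted size 1≤μ =
    ÷₀-intro (toℚ-pos {μ} 1≤μ) (÷₀-numerator 0≤D (toℚ-nonNeg (cI ℕ.+ cM)) bound)
    where
    D = toℚ (16 ℕ.* Δ) * (γ * γ)
    0≤D : 0ℚ ≤ D
    0≤D = 0≤-* (toℚ-nonNeg (16 ℕ.* Δ)) (0≤-* (1≤⇒0≤ 1≤γ) (1≤⇒0≤ 1≤γ))
    nonzero-degree : ∀ d → 0ℚ < toℚ (16 ℕ.* d) * (γ * γ) → 1 ℕ.≤ d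
    nonzero-degree zero 0<D = ⊥-elim (ℚP.<-irrefl (sym (ℚP.*-zeroˡ (γ * γ))) 0<D)
    nonzero-degree (suc d) _ = ℕ.s≤s ℕ.z≤n
    bound : 0ℚ < D → ψ * ψ' * toℚ μ ≤ D * toℚ (cI ℕ.+ cM)
    bound 0<D with ℚP.≤-total 0ℚ ψ'
    ... | inj₁ 0≤ψ' = scaled-cut-bound ψ ψ' γ Δ N a M cI cM e μ (ℚP.<⇒≤ 0<ψ) ψ≤1 1≤γ 0≤ψ' ψ'≤Δ
                        (nonzero-degree Δ 0<D) internal matching contracted size
    ... | inj₂ ψ'≤0 = begin
      ψ * ψ' * toℚ μ          ≤⟨ *-monoʳ-≤-0≤ (toℚ μ) (toℚ-nonNeg μ) (*-monoˡ-≤-0≤ ψ (ℚP.<⇒≤ 0<ψ) ψ'≤0) ⟩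
      ψ * 0ℚ * toℚ μ          ≡⟨ solve 2 (λ ψ μ → ψ :* con 0ℚ :* μ := con 0ℚ) refl ψ (toℚ μ) ⟩
      0ℚ                      ≤⟨ 0≤-* 0≤D (toℚ-nonNeg (cI ℕ.+ cM)) ⟩
      D * toℚ (cI ℕ.+ cM)     ∎

module FiniteSums where

  open import Defs using (count)
  open import Data.Bool using (Bool; true; false; not)
  open import Data.Nat as ℕ using (ℕ; suc; _+_; _*_; _≤_; z≤n)
  import Data.Nat.Properties as ℕP
  open import Data.Nat.ListAction using (sum)
  open import Data.Nat.ListAction.Properties using (sum-++)
  open import Data.Fin as Fin using (Fin)
  import Data.Fin.Properties as FinP
  open import Data.List using (List; []; _∷_; map; concatMap; length; allFin; lookup; tabulate; _++_)
  import Data.List.Properties as ListP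
  open import Data.List.Relation.Unary.All using (All; []; _∷_)
  open import Data.List.Relation.Unary.AllPairs using (_∷_)
  open import Data.List.Relation.Unary.Unique.Propositional using (Unique)
  open import Data.List.Relation.Unary.Any using (here; there)
  open import Data.List.Membership.Propositional using (_∈_)
  open import Relation.Binary.PropositionalEquality
  open import Relation.Nullary using (yes; no)
  open import Relation.Nullary.Decidable using (isYes)
  open import Data.Empty using (⊥-elim)

  open import Algebra.Properties.CommutativeSemigroup ℕP.+-commutativeSemigroup
    using () renaming (interchange to +-interchange)

  private variable A B : Set

  ind : Bool → ℕ
  ind true = 1
  ind false = 0

  ∑ : List A → (A → ℕ) → ℕ
  ∑ xs f = sum (map f xs)

  ∑-++ : (xs ys : List A) (f : A → ℕ) → ∑ (xs ++ ys) f ≡ ∑ xs f + ∑ ys f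
  ∑-++ xs ys f = trans (cong sum (ListP.map-++ f xs ys)) (sum-++ (map f xs) (map f ys))

  ∑-map : (g : B → A) (xs : List B) (f : A → ℕ) → ∑ (map g xs) f ≡ ∑ xs (λ x → f (g x))
  ∑-map g xs f = cong sum (sym (ListP.map-∘ xs))

  ∑-cong : (xs : List A) {f g : A → ℕ} → (∀ x → f x ≡ g x) → ∑ xs f ≡ ∑ xs g
  ∑-cong xs f≗g = cong sum (ListP.map-cong f≗g xs)

  ∑-concatMap : (g : B → List A) (xs : List B) (f : A → ℕ)
              → ∑ (concatMap g xs) f ≡ ∑ xs (λ x → ∑ (g x) f)
  ∑-concatMap g [] f = refl
  ∑-concatMap g (x ∷ xs) f = trans (∑-++ (g x) (concatMap g xs) f) (cong (∑ (g x) f +_) (∑-concatMap g xs f))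

  ∑-zero : (xs : List A) → ∑ xs (λ _ → 0) ≡ 0
  ∑-zero [] = refl
  ∑-zero (x ∷ xs) = ∑-zero xs

  ∑-mono : (xs : List A) {f g : A → ℕ} → (∀ x → f x ≤ g x) → ∑ xs f ≤ ∑ xs g
  ∑-mono [] f≤g = z≤n
  ∑-mono (x ∷ xs) f≤g = ℕP.+-mono-≤ (f≤g x) (∑-mono xs f≤g)

  ∑-mono-All : {P : A → Set} {xs : List A} {f g : A → ℕ} → All P xs → (∀ x → P x → f x ≤ g x) → ∑ xs f ≤ ∑ xs g
  ∑-mono-All [] f≤g = z≤n
  ∑-mono-All {xs = x ∷ _} (px ∷ pxs) f≤g = ℕP.+-mono-≤ (f≤g x px) (∑-mono-All pxs f≤g)

  ∑-+ : (xs : List A) (f g : A → ℕ) → ∑ xs (λ x → f x + g x) ≡ ∑ xs f + ∑ xs g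
  ∑-+ [] f g = refl
  ∑-+ (x ∷ xs) f g = trans (cong (f x + g x +_) (∑-+ xs f g)) (+-interchange (f x) (g x) (∑ xs f) (∑ xs g))

  ∑-*ʳ : (xs : List A) (f : A → ℕ) (c : ℕ) → ∑ xs (λ x → f x * c) ≡ ∑ xs f * c
  ∑-*ʳ [] f c = refl
  ∑-*ʳ (x ∷ xs) f c = trans (cong (f x * c +_) (∑-*ʳ xs f c)) (sym (ℕP.*-distribʳ-+ c (f x) (∑ xs f)))

  ∑-swap : (xs : List A) (ys : List B) (g : A → B → ℕ)
         → ∑ xs (λ x → ∑ ys (g x)) ≡ ∑ ys (λ y → ∑ xs (λ x → g x y))
  ∑-swap [] ys g = sym (∑-zero ys)
  ∑-swap (x ∷ xs) ys g =
    trans (cong (∑ ys (g x) +_) (∑-swap xs ys g)) (sym (∑-+ ys (g x) (λ y → ∑ xs (λ x → g x y))))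

  ∑-tabulate : ∀ {n} (f : Fin n → A) (g : A → ℕ) → ∑ (tabulate f) g ≡ ∑ (allFin n) (λ i → g (f i))
  ∑-tabulate f g = trans (cong sum (ListP.map-tabulate f g)) (cong sum (sym (ListP.map-tabulate (λ i → i) (λ i → g (f i)))))

  ∑-allFin-suc : ∀ n (g : Fin (suc n) → ℕ) → ∑ (allFin (suc n)) g ≡ g Fin.zero + ∑ (allFin n) (λ i → g (Fin.suc i))
  ∑-allFin-suc n g = cong (g Fin.zero +_) (∑-tabulate Fin.suc g)

  ∑-lookup : (xs : List A) (g : A → ℕ) → ∑ xs g ≡ ∑ (allFin (length xs)) (λ k → g (lookup xs k))
  ∑-lookup xs g = trans (cong (λ ys → ∑ ys g) (sym (ListP.tabulate-lookup xs))) (∑-tabulate (lookup xs) g)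

  member-≤-∑ : {a : A} {xs : List A} (g : A → ℕ) → a ∈ xs → g a ≤ ∑ xs g
  member-≤-∑ g (here refl) = ℕP.m≤m+n _ _
  member-≤-∑ {xs = x ∷ _} g (there a∈xs) = ℕP.≤-trans (member-≤-∑ g a∈xs) (ℕP.m≤n+m _ (g x))

  two-members-≤-∑ : {a b : A} {xs : List A} (g : A → ℕ) → a ∈ xs → b ∈ xs → a ≢ b → g a + g b ≤ ∑ xs g
  two-members-≤-∑ g (here refl) (here refl) a≢b = ⊥-elim (a≢b refl)
  two-members-≤-∑ g (here refl) (there b∈xs) _ = ℕP.+-monoʳ-≤ _ (member-≤-∑ g b∈xs)
  two-members-≤-∑ {a = a} {b} g (there a∈xs) (here refl) _ =
    ℕP.≤-trans (ℕP.≤-reflexive (ℕP.+-comm (g a) (g b))) (ℕP.+-monoʳ-≤ (g b) (member-≤-∑ g a∈xs))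
  two-members-≤-∑ {xs = x ∷ _} g (there a∈xs) (there b∈xs) a≢b =
    ℕP.≤-trans (two-members-≤-∑ g a∈xs b∈xs a≢b) (ℕP.m≤n+m _ (g x))

  count-∑ : (p : A → Bool) (xs : List A) → count p xs ≡ ∑ xs (λ x → ind (p x))
  count-∑ p [] = refl
  count-∑ p (x ∷ xs) with p x
  ... | true = cong suc (count-∑ p xs)
  ... | false = count-∑ p xs

  count-cong : {p q : A → Bool} (xs : List A) → (∀ x → p x ≡ q x) → count p xs ≡ count q xs
  count-cong {p = p} {q} xs p≗q =
    trans (count-∑ p xs) (trans (∑-cong xs (λ x → cong ind (p≗q x))) (sym (count-∑ q xs)))

  count-mono : {p q : A → Bool} (xs : List A) → (∀ x → ind (p x) ≤ ind (q x)) → count p xs ≤ count q xs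
  count-mono {p = p} {q} xs p≤q = subst₂ _≤_ (sym (count-∑ p xs)) (sym (count-∑ q xs)) (∑-mono xs p≤q)

  count-map : (p : A → Bool) (g : B → A) (xs : List B) → count p (map g xs) ≡ count (λ x → p (g x)) xs
  count-map p g xs = trans (count-∑ p (map g xs)) (trans (∑-map g xs _) (sym (count-∑ _ xs)))

  length-∑ : (xs : List A) → length xs ≡ ∑ xs (λ _ → 1)
  length-∑ [] = refl
  length-∑ (x ∷ xs) = cong suc (length-∑ xs)

  count-complement : (p : A → Bool) (xs : List A) → count p xs + count (λ x → not (p x)) xs ≡ length xs
  count-complement p [] = refl
  count-complement p (x ∷ xs) with p x
  ... | true = cong suc (count-complement p xs)
  ... | false = trans (ℕP.+-suc _ _) (cong suc (count-complement p xs))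

  δ : ∀ {n} → Fin n → Fin n → ℕ
  δ x y = ind (isYes (x FinP.≟ y))

  δ-suc : ∀ {n} (x y : Fin n) → δ (Fin.suc x) (Fin.suc y) ≡ δ x y
  δ-suc x y with x FinP.≟ y
  ... | yes _ = refl
  ... | no _ = refl

  ∑-δ : ∀ n (x : Fin n) (f : Fin n → ℕ) → ∑ (allFin n) (λ y → δ y x * f y) ≡ f x
  ∑-δ (suc n) Fin.zero f =
    trans (∑-allFin-suc n (λ y → δ y Fin.zero * f y))
          (trans (cong₂ _+_ (ℕP.+-identityʳ (f Fin.zero)) (∑-zero (allFin n))) (ℕP.+-identityʳ (f Fin.zero)))
  ∑-δ (suc n) (Fin.suc x) f =
    trans (∑-allFin-suc n (λ y → δ y (Fin.suc x) * f y))
          (trans (∑-cong (allFin n) (λ y → cong (_* f (Fin.suc y)) (δ-suc y x))) (∑-δ n x (λ y → f (Fin.suc y))))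

  count-singleton : ∀ n (v : Fin n) → count (λ u → isYes (u FinP.≟ v)) (allFin n) ≡ 1
  count-singleton n v =
    trans (count-∑ _ (allFin n)) (trans (∑-cong (allFin n) (λ u → sym (ℕP.*-identityʳ (δ u v)))) (∑-δ n v (λ _ → 1)))

  δ-absent : ∀ {n} {y : Fin n} {zs : List (Fin n)} → All (y ≢_) zs → ∑ zs (δ y) ≡ 0
  δ-absent [] = refl
  δ-absent {y = y} {z ∷ _} (y≢z ∷ rest) with y FinP.≟ z
  ... | yes y≡z = ⊥-elim (y≢z y≡z)
  ... | no _ = δ-absent rest

  δ-unique : ∀ {n} (xs : List (Fin n)) (y : Fin n) → Unique xs → ∑ xs (δ y) ≤ 1
  δ-unique [] y _ = z≤n
  δ-unique (x ∷ xs) y (x∉xs ∷ unique) with y FinP.≟ x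
  ... | yes refl = ℕP.≤-reflexive (cong suc (δ-absent x∉xs))
  ... | no _ = δ-unique xs y unique

  ∑-unique-≤ : ∀ {n} (xs : List (Fin n)) → Unique xs → (f : Fin n → ℕ) → ∑ xs f ≤ ∑ (allFin n) f
  ∑-unique-≤ {n} xs unique f = begin
    ∑ xs f                                          ≡⟨ ∑-cong xs (λ x → sym (∑-δ n x f)) ⟩
    ∑ xs (λ x → ∑ (allFin n) (λ y → δ y x * f y))   ≡⟨ ∑-swap xs (allFin n) (λ x y → δ y x * f y) ⟩
    ∑ (allFin n) (λ y → ∑ xs (λ x → δ y x * f y))   ≡⟨ ∑-cong (allFin n) (λ y → ∑-*ʳ xs (δ y) (f y)) ⟩
    ∑ (allFin n) (λ y → ∑ xs (δ y) * f y)           ≤⟨ ∑-mono (allFin n) (λ y → ℕP.*-monoˡ-≤ (f y) (δ-unique xs y unique)) ⟩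
    ∑ (allFin n) (λ y → 1 * f y)                    ≡⟨ ∑-cong (allFin n) (λ y → ℕP.*-identityˡ (f y)) ⟩
    ∑ (allFin n) f                                  ∎
    where open ℕP.≤-Reasoning

  count-unique-≤ : ∀ {n} (xs : List (Fin n)) → Unique xs → (p : Fin n → Bool) → count p xs ≤ count p (allFin n)
  count-unique-≤ {n} xs unique p =
    subst₂ _≤_ (sym (count-∑ p xs)) (sym (count-∑ p (allFin n))) (∑-unique-≤ xs unique (λ x → ind (p x)))

module RationalSums where

  open import Defs using (toℚ)
  open import Data.Nat as ℕ using (ℕ)
  open import Data.List using (List; []; _∷_)
  open import Data.Rational using (ℚ; _*_; _+_; _≤_)
  import Data.Rational.Properties as ℚP
  open import Relation.Binary.PropositionalEquality
  open RationalArithmetic using (toℚ-+)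
  open FiniteSums using (∑)
  open ℚP.≤-Reasoning

  private variable A : Set

  ∑-scaleˡ : (c : ℚ) (xs : List A) (f g : A → ℕ)
           → (∀ x → c * toℚ (f x) ≤ toℚ (g x)) → c * toℚ (∑ xs f) ≤ toℚ (∑ xs g)
  ∑-scaleˡ c [] f g _ = ℚP.≤-reflexive (ℚP.*-zeroʳ c)
  ∑-scaleˡ c (x ∷ xs) f g cf≤g = begin
    c * toℚ (f x ℕ.+ ∑ xs f)             ≡⟨ trans (cong (c *_) (toℚ-+ (f x) _)) (ℚP.*-distribˡ-+ c _ _) ⟩
    c * toℚ (f x) + c * toℚ (∑ xs f)     ≤⟨ ℚP.+-mono-≤ (cf≤g x) (∑-scaleˡ c xs f g cf≤g) ⟩
    toℚ (g x) + toℚ (∑ xs g)             ≡⟨ sym (toℚ-+ (g x) _) ⟩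
    toℚ (g x ℕ.+ ∑ xs g)                 ∎

  ∑-scaleʳ : (c : ℚ) (xs : List A) (f g : A → ℕ)
           → (∀ x → toℚ (f x) ≤ c * toℚ (g x)) → toℚ (∑ xs f) ≤ c * toℚ (∑ xs g)
  ∑-scaleʳ c [] f g _ = ℚP.≤-reflexive (sym (ℚP.*-zeroʳ c))
  ∑-scaleʳ c (x ∷ xs) f g f≤cg = begin
    toℚ (f x ℕ.+ ∑ xs f)                 ≡⟨ toℚ-+ (f x) _ ⟩
    toℚ (f x) + toℚ (∑ xs f)             ≤⟨ ℚP.+-mono-≤ (f≤cg x) (∑-scaleʳ c xs f g f≤cg) ⟩
    c * toℚ (g x) + c * toℚ (∑ xs g)     ≡⟨ sym (trans (cong (c *_) (toℚ-+ (g x) _)) (ℚP.*-distribˡ-+ c _ _)) ⟩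
    c * toℚ (g x ℕ.+ ∑ xs g)             ∎

module GraphFacts where

  open import Defs
  open import Data.Bool using (Bool; true; false; not; _xor_; _∨_)
  open import Data.Bool.Properties using (∨-zeroʳ)
  open import Data.Nat as ℕ using (ℕ; zero; suc; _+_; _*_; _≤_; _⊓_; z≤n; s≤s)
  import Data.Nat.Properties as ℕP
  open import Data.Fin as Fin using (Fin)
  import Data.Fin.Properties as FinP
  open import Data.List using (List; map; length; allFin)
  import Data.List.Properties as ListP
  import Data.List.Relation.Unary.All as All
  open import Data.List.Relation.Unary.All.Properties using (map⁻)
  open import Data.List.Relation.Unary.Unique.Propositional using (Unique)
  open import Data.List.Membership.Propositional.Properties using (∈-allFin)
  open import Data.Product using (_×_; _,_; proj₁; proj₂)
  open import Data.Rational as ℚ using (ℚ)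
  import Data.Rational.Properties as ℚP
  open import Relation.Binary.PropositionalEquality
  open import Relation.Nullary using (yes; no)
  open import Relation.Nullary.Decidable using (isYes)
  open import Data.Empty using (⊥-elim)
  open RationalArithmetic
  open FiniteSums

  -- A ψ-expander satisfies ψ · min(|S|, |V ∖ S|) ≤ |E(S, V ∖ S)| for every cut S,
  -- including the trivial cuts, where the left side vanishes.
  expander-bound : {V : Set} (vs : List V) (E : Edges V) (ψ : ℚ) → IsExpander vs E ψ → (S : V → Bool)
    → ψ ℚ.* toℚ (count S vs ⊓ count (λ v → not (S v)) vs) ℚ.≤ toℚ (crossing S E)
  expander-bound vs E ψ expander S = product-form (count S vs) (count (λ v → not (S v)) vs) (expander S)
    where
    product-form : ∀ x y → (1 ≤ x → 1 ≤ y → ψ ℚ.≤ toℚ (crossing S E) ÷₀ toℚ (x ⊓ y))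
                 → ψ ℚ.* toℚ (x ⊓ y) ℚ.≤ toℚ (crossing S E)
    product-form zero y _ = ℚP.≤-trans (ℚP.≤-reflexive (ℚP.*-zeroʳ ψ)) (toℚ-nonNeg (crossing S E))
    product-form (suc x) zero _ = ℚP.≤-trans (ℚP.≤-reflexive (ℚP.*-zeroʳ ψ)) (toℚ-nonNeg (crossing S E))
    product-form (suc x) (suc y) sparse = ÷₀-elim (toℚ-pos {suc (x ⊓ y)} (s≤s z≤n)) (sparse (s≤s z≤n) (s≤s z≤n))

  degree≤maxDegree : ∀ h (E : Edges (Fin h)) v → degree E v ≤ maxDegree h E
  degree≤maxDegree h E v = All.lookup (map⁻ degrees≤max) (∈-allFin v)
    where
    degrees≤max : All.All (_≤ maxDegree h E) (map (degree E) (allFin h))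
    degrees≤max = ListP.foldr-forcesᵇ {P = _≤ maxDegree h E}
      (λ x y x⊔y≤ → ℕP.m⊔n≤o⇒m≤o x y x⊔y≤ , ℕP.m⊔n≤o⇒n≤o x y x⊔y≤) 0 _ ℕP.≤-refl

  -- Testing expansion on a single vertex: the expansion of a graph with at least
  -- two vertices is at most its maximum degree.
  expansion≤maxDegree : ∀ h → 1 ℕ.< h → (E : Edges (Fin h)) (ψ : ℚ)
    → IsExpander (allFin h) E ψ → ψ ℚ.≤ toℚ (maxDegree h E)
  expansion≤maxDegree (suc zero) (s≤s ())
  expansion≤maxDegree (suc (suc k)) _ E ψ expander = begin
    ψ                                ≡⟨ sym (ℚP.*-identityʳ ψ) ⟩
    ψ ℚ.* toℚ 1                      ≡⟨ cong (λ μ → ψ ℚ.* toℚ μ) (sym singleton-side) ⟩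
    ψ ℚ.* toℚ (count T vs ⊓ count (λ u → not (T u)) vs)
                                     ≤⟨ expander-bound vs E ψ expander T ⟩
    toℚ (crossing T E)               ≤⟨ toℚ-mono (ℕP.≤-trans crossing≤degree (degree≤maxDegree h E Fin.zero)) ⟩
    toℚ (maxDegree h E)              ∎
    where
    open ℚP.≤-Reasoning
    h = suc (suc k)
    vs = allFin h
    T : Fin h → Bool
    T u = isYes (u FinP.≟ Fin.zero)
    rest : count (λ u → not (T u)) vs ≡ suc k
    rest = ℕP.suc-injective (trans (cong (_+ count (λ u → not (T u)) vs) (sym (count-singleton h Fin.zero)))
                                   (trans (count-complement T vs) (ListP.length-tabulate (λ u → u))))
    singleton-side : count T vs ⊓ count (λ u → not (T u)) vs ≡ 1
    singleton-side = cong₂ _⊓_ (count-singleton h Fin.zero) rest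
    xor≤∨ : ∀ x y → ind (x xor y) ≤ ind (x ∨ y)
    xor≤∨ true true = z≤n
    xor≤∨ true false = s≤s z≤n
    xor≤∨ false true = s≤s z≤n
    xor≤∨ false false = z≤n
    crossing≤degree : crossing T E ≤ degree E Fin.zero
    crossing≤degree = count-mono E (λ e → xor≤∨ (T (proj₁ e)) (T (proj₂ e)))

  isYes-refl : ∀ {h} (v : Fin h) → isYes (v FinP.≟ v) ≡ true
  isYes-refl v with v FinP.≟ v
  ... | yes _ = refl
  ... | no v≢v = ⊥-elim (v≢v refl)

  -- Handshake bound: a loopless edge has two distinct endpoints, and each vertex v
  -- is an endpoint of degree E v ≤ Δ edges; hence Σ_{(u,w) ∈ E} (m u + m w) ≤ Δ · Σ_v m v.
  handshake-bound : ∀ h (E : Edges (Fin h)) → Loopless E → (m : Fin h → ℕ)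
    → ∑ E (λ e → m (proj₁ e) + m (proj₂ e)) ≤ maxDegree h E * ∑ (allFin h) m
  handshake-bound h E loopless m = begin
    ∑ E (λ e → m (proj₁ e) + m (proj₂ e))                   ≤⟨ ∑-mono-All loopless endpoints≤incidences ⟩
    ∑ E (λ e → ∑ (allFin h) (λ v → ind (incident e v) * m v)) ≡⟨ ∑-swap E (allFin h) (λ e v → ind (incident e v) * m v) ⟩
    ∑ (allFin h) (λ v → ∑ E (λ e → ind (incident e v) * m v)) ≡⟨ ∑-cong (allFin h) (λ v → trans (∑-*ʳ E (λ e → ind (incident e v)) (m v))
                                                                  (cong (_* m v) (sym (count-∑ (λ e → incident e v) E)))) ⟩
    ∑ (allFin h) (λ v → degree E v * m v)                   ≤⟨ ∑-mono (allFin h) (λ v → ℕP.*-monoˡ-≤ (m v) (degree≤maxDegree h E v)) ⟩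
    ∑ (allFin h) (λ v → maxDegree h E * m v)                ≡⟨ trans (∑-cong (allFin h) (λ v → ℕP.*-comm (maxDegree h E) (m v)))
                                                                (trans (∑-*ʳ (allFin h) m (maxDegree h E)) (ℕP.*-comm _ (maxDegree h E))) ⟩
    maxDegree h E * ∑ (allFin h) m                          ∎
    where
    open ℕP.≤-Reasoning
    incident : Fin h × Fin h → Fin h → Bool
    incident e v = isYes (proj₁ e FinP.≟ v) ∨ isYes (proj₂ e FinP.≟ v)
    endpoints≤incidences : ∀ e → proj₁ e ≢ proj₂ e
      → m (proj₁ e) + m (proj₂ e) ≤ ∑ (allFin h) (λ v → ind (incident e v) * m v)
    endpoints≤incidences (u , w) u≢w =
      subst (_≤ ∑ (allFin h) (λ v → ind (incident (u , w) v) * m v)) (cong₂ _+_ left right) (two-members-≤-∑ (λ v → ind (incident (u , w) v) * m v) (∈-allFin u) (∈-allFin w) u≢w)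
      where
      left : ind (incident (u , w) u) * m u ≡ m u
      left rewrite isYes-refl u = ℕP.+-identityʳ (m u)
      right : ind (incident (u , w) w) * m w ≡ m w
      right rewrite isYes-refl w | ∨-zeroʳ (isYes (u FinP.≟ w)) = ℕP.+-identityʳ (m w)

  -- Expect the left vertices on side b and the right
  -- vertices on side not b.  Each matched pair (u , w) either crosses the labelling
  -- (S₁ u ≠ S₂ w) or has an endpoint off its expected side, so the matching has at most
  -- #{crossing pairs} + #{u : S₁ u ≠ b} + #{w : S₂ w ≠ not b} pairs.
  matching-bound : ∀ {a a'} (ps : List (Fin a × Fin a')) → Unique (map proj₁ ps) → Unique (map proj₂ ps)
    → (S₁ : Fin a → Bool) (S₂ : Fin a' → Bool) (b : Bool)
    → length ps ≤ count (λ q → S₁ (proj₁ q) xor S₂ (proj₂ q)) ps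
                  + (count (λ u → S₁ u xor b) (allFin a) + count (λ w → S₂ w xor not b) (allFin a'))
  matching-bound {a} {a'} ps unique₁ unique₂ S₁ S₂ b = begin
    length ps
      ≡⟨ length-∑ ps ⟩
    ∑ ps (λ _ → 1)
      ≤⟨ ∑-mono ps (λ q → pair-is-paid-for (S₁ (proj₁ q)) (S₂ (proj₂ q)) b) ⟩
    ∑ ps (λ q → ind (crosses q) + (ind (S₁ (proj₁ q) xor b) + ind (S₂ (proj₂ q) xor not b)))
      ≡⟨ trans (∑-+ ps _ _) (cong (∑ ps (λ q → ind (crosses q)) +_) (∑-+ ps _ _)) ⟩
    ∑ ps (λ q → ind (crosses q)) + (∑ ps (λ q → ind (S₁ (proj₁ q) xor b)) + ∑ ps (λ q → ind (S₂ (proj₂ q) xor not b)))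
      ≡⟨ sym (cong₂ _+_ (count-∑ crosses ps) (cong₂ _+_ (count-∑ _ ps) (count-∑ _ ps))) ⟩
    count crosses ps + (count (λ q → S₁ (proj₁ q) xor b) ps + count (λ q → S₂ (proj₂ q) xor not b) ps)
      ≡⟨ sym (cong (count crosses ps +_) (cong₂ _+_ (count-map _ proj₁ ps) (count-map _ proj₂ ps))) ⟩
    count crosses ps + (count (λ u → S₁ u xor b) (map proj₁ ps) + count (λ w → S₂ w xor not b) (map proj₂ ps))
      ≤⟨ ℕP.+-monoʳ-≤ (count crosses ps) (ℕP.+-mono-≤ (count-unique-≤ _ unique₁ _) (count-unique-≤ _ unique₂ _)) ⟩
    count crosses ps + (count (λ u → S₁ u xor b) (allFin a) + count (λ w → S₂ w xor not b) (allFin a'))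
      ∎
    where
    open ℕP.≤-Reasoning
    crosses : Fin a × Fin a' → Bool
    crosses q = S₁ (proj₁ q) xor S₂ (proj₂ q)
    pair-is-paid-for : ∀ x y b → 1 ≤ ind (x xor y) + (ind (x xor b) + ind (y xor not b))
    pair-is-paid-for true  false _     = s≤s z≤n
    pair-is-paid-for false true  _     = s≤s z≤n
    pair-is-paid-for true  true  true  = s≤s z≤n
    pair-is-paid-for true  true  false = s≤s z≤n
    pair-is-paid-for false false true  = s≤s z≤n
    pair-is-paid-for false false false = s≤s z≤n

module CompositionStructure {h : ℕ} (N : ℕ) (n : Fin h → ℕ) (EG : (i : Fin h) → Edges (Fin (n i)))
                            (EH : Edges (Fin h)) (M : CompositionData N h n EH) where

  open import Data.Bool using (Bool; _xor_)
  open import Data.List using (map; concatMap; length; allFin; lookup; _++_)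
  open import Data.Product using (_×_; _,_; proj₁; proj₂)
  open import Relation.Binary.PropositionalEquality
  open FiniteSums

  tail head : Fin (length EH) → Fin h
  tail k = proj₁ (lookup EH k)
  head k = proj₂ (lookup EH k)

  count-unionVs : (P : UnionV h n → Bool)
    → count P (unionVs h n) ≡ ∑ (allFin h) (λ i → count (λ x → P (i , x)) (allFin (n i)))
  count-unionVs P = begin
    count P (unionVs h n)                                               ≡⟨ count-∑ P (unionVs h n) ⟩
    ∑ (unionVs h n) (λ v → ind (P v))                                   ≡⟨ ∑-concatMap _ (allFin h) _ ⟩
    ∑ (allFin h) (λ i → ∑ (map (i ,_) (allFin (n i))) (λ v → ind (P v))) ≡⟨ ∑-cong (allFin h) (λ i →
                                                                             trans (∑-map _ (allFin (n i)) _) (sym (count-∑ _ (allFin (n i))))) ⟩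
    ∑ (allFin h) (λ i → count (λ x → P (i , x)) (allFin (n i)))         ∎
    where open ≡-Reasoning

  crossing-composition : (S : UnionV h n → Bool)
    → crossing S (compositionEdges N h n EG EH M)
      ≡ ∑ (allFin h) (λ i → crossing (λ x → S (i , x)) (EG i))
        ℕ.+ ∑ (allFin (length EH)) (λ k → count (λ p → S (tail k , proj₁ p) xor S (head k , proj₂ p)) (pairs (M k)))
  crossing-composition S = begin
    crossing S (internal ++ matched)                       ≡⟨ count-∑ crosses (internal ++ matched) ⟩
    ∑ (internal ++ matched) (λ ε → ind (crosses ε))        ≡⟨ ∑-++ internal matched _ ⟩
    ∑ internal (λ ε → ind (crosses ε)) ℕ.+ ∑ matched (λ ε → ind (crosses ε))
      ≡⟨ cong₂ ℕ._+_
           (trans (∑-concatMap _ (allFin h) _) (∑-cong (allFin h) (λ i → trans (∑-map _ (EG i) _) (sym (count-∑ _ (EG i))))))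
           (trans (∑-concatMap _ (allFin (length EH)) _)
                  (∑-cong (allFin (length EH)) (λ k → trans (∑-map _ (pairs (M k)) _) (sym (count-∑ _ (pairs (M k))))))) ⟩
    ∑ (allFin h) (λ i → crossing (λ x → S (i , x)) (EG i))
      ℕ.+ ∑ (allFin (length EH)) (λ k → count (λ p → S (tail k , proj₁ p) xor S (head k , proj₂ p)) (pairs (M k)))  ∎
    where
    open ≡-Reasoning
    crosses : UnionV h n × UnionV h n → Bool
    crosses ε = S (proj₁ ε) xor S (proj₂ ε)
    internal matched : Edges (UnionV h n)
    internal = concatMap (λ i → map (λ e → ((i , proj₁ e) , (i , proj₂ e))) (EG i)) (allFin h)
    matched = concatMap (λ k → map (λ p → ((tail k , proj₁ p) , (head k , proj₂ p))) (pairs (M k))) (allFin (length EH))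

-- S is cut into the slices
-- S_i = S ∩ V_i; the minority side of V_i is the smaller of S_i, V_i ∖ S_i, and
-- contracting every V_i to the side of its majority gives a cut of H.
module CutOfComposition {h : ℕ} (N : ℕ) (n : Fin h → ℕ) (EG : (i : Fin h) → Edges (Fin (n i)))
                        (EH : Edges (Fin h)) (M : CompositionData N h n EH) (S : UnionV h n → Bool) where

  open import Data.Bool using (Bool; true; false; not; _xor_)
  open import Data.Bool.Properties using (xor-comm; true-xor; xor-identityʳ)
  open import Data.Nat as ℕ using (ℕ; _+_; _*_; _≤_; _≤?_; _⊓_; z≤n)
  import Data.Nat.Properties as ℕP
  open import Data.List using (length; allFin; lookup)
  import Data.List.Properties as ListP
  open import Data.Product using (_×_; _,_; proj₁; proj₂)
  open import Data.Rational as ℚ using (ℚ)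
  import Data.Rational.Properties as ℚP
  open import Relation.Binary.PropositionalEquality
  open import Relation.Nullary using (yes; no)
  open import Relation.Nullary.Decidable using (isYes)
  open RationalArithmetic
  open FiniteSums
  open RationalSums
  open GraphFacts
  open CompositionStructure N n EG EH M

  slice : (i : Fin h) → Fin (n i) → Bool
  slice i x = S (i , x)

  inside outside minority : Fin h → ℕ
  inside i = count (slice i) (allFin (n i))
  outside i = count (λ x → not (slice i x)) (allFin (n i))
  minority i = inside i ⊓ outside i

  majority : Fin h → Bool
  majority i = isYes (outside i ≤? inside i)

  matchingCrossing : Fin (length EH) → ℕ
  matchingCrossing k = count (λ p → slice (tail k) (proj₁ p) xor slice (head k) (proj₂ p)) (pairs (M k))

  totalMinority internalCrossing matchingCrossings contractedSize contractedBoundary cutSize : ℕ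
  totalMinority = ∑ (allFin h) minority
  internalCrossing = ∑ (allFin h) (λ i → crossing (slice i) (EG i))
  matchingCrossings = ∑ (allFin (length EH)) matchingCrossing
  contractedSize = count majority (allFin h) ⊓ count (λ i → not (majority i)) (allFin h)
  contractedBoundary = crossing majority EH
  cutSize = count S (unionVs h n) ⊓ count (λ v → not (S v)) (unionVs h n)

  crossing-split : internalCrossing + matchingCrossings ≡ crossing S (compositionEdges N h n EG EH M)
  crossing-split = sym (crossing-composition S)

  internal-bound : (ψ : ℚ) → ((i : Fin h) → IsExpander (allFin (n i)) (EG i) ψ)
    → ψ ℚ.* toℚ totalMinority ℚ.≤ toℚ internalCrossing
  internal-bound ψ expanders =
    ∑-scaleˡ ψ (allFin h) minority _ (λ i → expander-bound (allFin (n i)) (EG i) ψ (expanders i) (slice i))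

  majority-part : ∀ s t → s ≤ ind (isYes (t ≤? s)) * (s + t) + s ⊓ t
  majority-part s t with t ≤? s
  ... | yes _ = ℕP.≤-trans (ℕP.m≤m+n s t) (ℕP.≤-trans (ℕP.m≤m+n (s + t) 0) (ℕP.m≤m+n _ (s ⊓ t)))
  ... | no t≰s = ℕP.≤-reflexive (sym (ℕP.m≤n⇒m⊓n≡m (ℕP.<⇒≤ (ℕP.≰⇒> t≰s))))

  minority-part : ∀ s t → t ≤ ind (not (isYes (t ≤? s))) * (s + t) + s ⊓ t
  minority-part s t with t ≤? s
  ... | yes t≤s = ℕP.≤-reflexive (sym (ℕP.m≥n⇒m⊓n≡n t≤s))
  ... | no _ = ℕP.≤-trans (ℕP.m≤n+m t s) (ℕP.≤-trans (ℕP.m≤m+n (s + t) 0) (ℕP.m≤m+n _ (s ⊓ t)))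

  size-of-slices : ∀ i → inside i + outside i ≡ n i
  size-of-slices i = trans (count-complement (slice i) (allFin (n i))) (ListP.length-tabulate (λ x → x))

  -- Each side of the cut is covered by the V_i of the corresponding side of the
  -- contracted cut, up to the minority vertices: with |V_i| ≤ γN this gives
  -- min(|S|, |V ∖ S|) ≤ γN · min(|A|, |V(H) ∖ A|) + M.
  cut-size-bound : (γ : ℚ) → ((i : Fin h) → toℚ (n i) ℚ.≤ γ ℚ.* toℚ N)
    → toℚ cutSize ℚ.≤ γ ℚ.* toℚ N ℚ.* toℚ contractedSize ℚ.+ toℚ totalMinority
  cut-size-bound γ small =
    toℚ-⊓-bound (count S (unionVs h n)) (count (λ v → not (S v)) (unionVs h n))
                (count majority (allFin h)) (count (λ i → not (majority i)) (allFin h))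
                (λ z → γ ℚ.* toℚ N ℚ.* toℚ z ℚ.+ toℚ totalMinority)
                (side-bound majority S (λ i → majority-part (inside i) (outside i)))
                (side-bound (λ i → not (majority i)) (λ v → not (S v)) (λ i → minority-part (inside i) (outside i)))
    where
    open ℚP.≤-Reasoning
    side-bound : (B : Fin h → Bool) (P : UnionV h n → Bool)
      → (∀ i → count (λ x → P (i , x)) (allFin (n i)) ≤ ind (B i) * (inside i + outside i) + minority i)
      → toℚ (count P (unionVs h n)) ℚ.≤ γ ℚ.* toℚ N ℚ.* toℚ (count B (allFin h)) ℚ.+ toℚ totalMinority
    side-bound B P covered = begin
      toℚ (count P (unionVs h n))
        ≡⟨ cong toℚ (count-unionVs P) ⟩
      toℚ (∑ (allFin h) (λ i → count (λ x → P (i , x)) (allFin (n i))))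
        ≤⟨ toℚ-mono (∑-mono (allFin h) covered′) ⟩
      toℚ (∑ (allFin h) (λ i → ind (B i) * n i + minority i))
        ≡⟨ trans (cong toℚ (∑-+ (allFin h) (λ i → ind (B i) * n i) minority)) (toℚ-+ (∑ (allFin h) (λ i → ind (B i) * n i)) totalMinority) ⟩
      toℚ (∑ (allFin h) (λ i → ind (B i) * n i)) ℚ.+ toℚ totalMinority
        ≤⟨ ℚP.+-monoˡ-≤ (toℚ totalMinority) (∑-scaleʳ (γ ℚ.* toℚ N) (allFin h) _ (λ i → ind (B i)) (λ i → whole-part (B i) i)) ⟩
      γ ℚ.* toℚ N ℚ.* toℚ (∑ (allFin h) (λ i → ind (B i))) ℚ.+ toℚ totalMinority
        ≡⟨ cong (λ z → γ ℚ.* toℚ N ℚ.* toℚ z ℚ.+ toℚ totalMinority) (sym (count-∑ B (allFin h))) ⟩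
      γ ℚ.* toℚ N ℚ.* toℚ (count B (allFin h)) ℚ.+ toℚ totalMinority ∎
      where
      covered′ : ∀ i → count (λ x → P (i , x)) (allFin (n i)) ≤ ind (B i) * n i + minority i
      covered′ i = subst (λ m → count (λ x → P (i , x)) (allFin (n i)) ≤ ind (B i) * m + minority i) (size-of-slices i) (covered i)
      whole-part : ∀ b i → toℚ (ind b * n i) ℚ.≤ γ ℚ.* toℚ N ℚ.* toℚ (ind b)
      whole-part true i = ℚP.≤-trans (ℚP.≤-reflexive (cong toℚ (ℕP.*-identityˡ (n i))))
                                     (ℚP.≤-trans (small i) (ℚP.≤-reflexive (sym (ℚP.*-identityʳ _))))
      whole-part false i = ℚP.≤-reflexive (sym (ℚP.*-zeroʳ (γ ℚ.* toℚ N)))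

  minority-deviates : ∀ i → count (λ x → slice i x xor majority i) (allFin (n i)) ≡ minority i
  minority-deviates i with outside i ≤? inside i
  ... | yes outside≤inside = trans (count-cong (allFin (n i)) (λ x → trans (xor-comm (slice i x) true) (true-xor (slice i x))))
                                   (sym (ℕP.m≥n⇒m⊓n≡n outside≤inside))
  ... | no outside≰inside = trans (count-cong (allFin (n i)) (λ x → xor-identityʳ (slice i x)))
                                  (sym (ℕP.m≤n⇒m⊓n≡m (ℕP.<⇒≤ (ℕP.≰⇒> outside≰inside))))

  -- If the endpoints of the k-th edge of H lie on different sides of the contracted
  -- cut, each of its N matched pairs crosses S or meets a minority vertex.
  boundary-edge-bound : ∀ k → ind (majority (tail k) xor majority (head k)) * N
                            ≤ matchingCrossing k + (minority (tail k) + minority (head k))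
  boundary-edge-bound k = on-boundary (majority (tail k)) (majority (head k)) pairs-paid-for
    where
    on-boundary : ∀ b₁ b₂ {X} → (b₂ ≡ not b₁ → N ≤ X) → ind (b₁ xor b₂) * N ≤ X
    on-boundary true  true  _ = z≤n
    on-boundary false false _ = z≤n
    on-boundary true  false N≤X = subst (_≤ _) (sym (ℕP.+-identityʳ N)) (N≤X refl)
    on-boundary false true  N≤X = subst (_≤ _) (sym (ℕP.+-identityʳ N)) (N≤X refl)
    pairs-paid-for : majority (head k) ≡ not (majority (tail k))
                   → N ≤ matchingCrossing k + (minority (tail k) + minority (head k))
    pairs-paid-for opposite =
      subst (_≤ matchingCrossing k + (minority (tail k) + minority (head k)))
            (card (M k))
            (subst (λ X → length (pairs (M k)) ≤ matchingCrossing k + X)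
                   (cong₂ _+_ (minority-deviates (tail k))
                              (trans (cong (λ b → count (λ w → slice (head k) w xor b) (allFin (n (head k)))) (sym opposite))
                                     (minority-deviates (head k))))
                   (matching-bound (pairs (M k)) (uniqueˡ (M k)) (uniqueʳ (M k))
                                   (slice (tail k)) (slice (head k)) (majority (tail k))))

  contracted-boundary-bound : Loopless EH
    → contractedBoundary * N ≤ matchingCrossings + maxDegree h EH * totalMinority
  contracted-boundary-bound loopless = begin
    contractedBoundary * N
      ≡⟨ cong (_* N) (count-∑ crossesA EH) ⟩
    ∑ EH (λ ε → ind (crossesA ε)) * N
      ≡⟨ sym (∑-*ʳ EH (λ ε → ind (crossesA ε)) N) ⟩
    ∑ EH (λ ε → ind (crossesA ε) * N)
      ≡⟨ ∑-lookup EH (λ ε → ind (crossesA ε) * N) ⟩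
    ∑ (allFin (length EH)) (λ k → ind (crossesA (lookup EH k)) * N)
      ≤⟨ ∑-mono (allFin (length EH)) boundary-edge-bound ⟩
    ∑ (allFin (length EH)) (λ k → matchingCrossing k + (minority (tail k) + minority (head k)))
      ≡⟨ ∑-+ (allFin (length EH)) matchingCrossing (λ k → minority (tail k) + minority (head k)) ⟩
    matchingCrossings + ∑ (allFin (length EH)) (λ k → minority (tail k) + minority (head k))
      ≡⟨ cong (matchingCrossings +_) (sym (∑-lookup EH (λ ε → minority (proj₁ ε) + minority (proj₂ ε)))) ⟩
    matchingCrossings + ∑ EH (λ ε → minority (proj₁ ε) + minority (proj₂ ε))
      ≤⟨ ℕP.+-monoʳ-≤ matchingCrossings (handshake-bound h EH loopless minority) ⟩
    matchingCrossings + maxDegree h EH * totalMinority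
      ∎
    where
    open ℕP.≤-Reasoning
    crossesA : Fin h × Fin h → Bool
    crossesA ε = majority (proj₁ ε) xor majority (proj₂ ε)

open import Data.List using (allFin)
open import Data.Rational using (ℚ; 0ℚ; 1ℚ; _*_)
import Data.Nat.Properties as ℕP
open RationalArithmetic using (expansion-from-counts)
open GraphFacts using (expander-bound; expansion≤maxDegree)

theorem4p4 : (h N : ℕ) (γ ψ ψ' : ℚ)
    → 1 Data.Nat.< h → 1 Data.Nat.≤ N → 1ℚ Data.Rational.≤ γ
    → 0ℚ Data.Rational.< ψ → ψ Data.Rational.≤ 1ℚ
    → (n : Fin h → ℕ) (EG : (i : Fin h) → Edges (Fin (n i)))
    → ((i : Fin h) → Loopless (EG i))
    → ((i : Fin h) → N Data.Nat.≤ n i)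
    → ((i : Fin h) → toℚ (n i) Data.Rational.≤ γ * toℚ N)
    → ((i : Fin h) → IsExpander (allFin (n i)) (EG i) ψ)
    → (EH : Edges (Fin h)) → Loopless EH
    → IsExpander (allFin h) EH ψ'
    → (M : CompositionData N h n EH)
    → IsExpander (unionVs h n) (compositionEdges N h n EG EH M)
        ((ψ * ψ') ÷₀ (toℚ (16 Data.Nat.* maxDegree h EH) * (γ * γ)))
theorem4p4 h N γ ψ ψ' 1<h _ 1≤γ 0<ψ ψ≤1 n EG _ _ small expanders EH loopless expanderH M S S≢∅ S≢V =
  expansion-from-counts ψ ψ' γ (maxDegree h EH) N contractedSize totalMinority internalCrossing
    matchingCrossings (crossing S (compositionEdges N h n EG EH M)) contractedBoundary cutSize
    crossing-split 0<ψ ψ≤1 1≤γ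
    (expansion≤maxDegree h 1<h EH ψ' expanderH)
    (internal-bound ψ expanders)
    (contracted-boundary-bound loopless)
    (expander-bound (allFin h) EH ψ' expanderH majority)
    (cut-size-bound γ small)
    (ℕP.⊓-glb S≢∅ S≢V)
  where open CutOfComposition N n EG EH M S
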